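{- If a graph $G$ has no perfect matching, then $w_{def}(G)\geq 2\delta(G)-def(G)$, where $\delta(G)$ is the minimum degree of $G$.
   Context: All graphs are finite, undirected, without loops or multiple edges. A proper $t$-edge-coloring of $G$ is a map $\alpha:E(G)\to\{1,\ldots,t\}$ such that all $t$ colors are used and adjacent edges receive different colors. The spectrum $S(v,\alpha)$ of a vertex $v$ is the set of colors on edges incident to $v$. For a finite set $A$ of integers, $def(A)=\max A-\min A-|A|+1$ ($def(\emptyset)=0$). Define $def(v,\alpha)=def(S(v,\alpha))$, $def(G,\alpha)=\sum_{v\in V(G)}def(v,\alpha)$, and $def(G)=\min_\alpha def(G,\alpha)$ over all proper edge-colorings $\alpha$ of $G$. $w_{def}(G)$ is the smallest $t$ such that $G$ has a proper $t$-edge-coloring $\alpha$ with $def(G,\alpha)=def(G)$. -}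

module Defs where

open import Data.Nat using (ℕ; zero; suc; _+_; _∸_; _≤_; _⊔_; _⊓_; _≟_)
open import Data.Bool using (Bool; true; false; T)
open import Data.Fin using (Fin)
open import Data.List using (List; []; _∷_; map; filter; length; foldr; deduplicate)
open import Data.Nat.ListAction using (sum)
open import Data.List.Base using (allFin)
open import Data.Product using (Σ; _×_; ∃)
open import Relation.Binary.PropositionalEquality using (_≡_; _≢_)
open import Relation.Nullary.Decidable using (does; yes; no)
open import Data.Bool using () renaming (_≟_ to _≟ᵇ_)

record Graph : Set where
  field
    n     : ℕ
    adj   : Fin n → Fin n → Bool
    sym   : ∀ u v → adj u v ≡ adj v u
    irrefl : ∀ v → adj v v ≡ false
open Graph public

Adj : (G : Graph) → Fin (n G) → Fin (n G) → Set
Adj G u v = T (adj G u v)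

nbrs : (G : Graph) → Fin (n G) → List (Fin (n G))
nbrs G v = filter (λ u → adj G v u ≟ᵇ true) (allFin (n G))

degree : (G : Graph) → Fin (n G) → ℕ
degree G v = length (nbrs G v)

minList : ℕ → List ℕ → ℕ
minList d []       = d
minList d (x ∷ xs) = foldr _⊓_ x xs

maxList : List ℕ → ℕ
maxList = foldr _⊔_ 0

-- minimum degree δ(G) (0 for the graph with no vertices)
δ : Graph → ℕ
δ G = minList 0 (map (degree G) (allFin (n G)))

-- A perfect matching, encoded as a fixed-point-free involution along edges:
-- every vertex v is matched to exactly the vertex m v, which is adjacent to v.
HasPerfectMatching : Graph → Set
HasPerfectMatching G =
  Σ (Fin (n G) → Fin (n G)) λ m →
    (∀ v → Adj G v (m v)) × (∀ v → m (m v) ≡ v)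

-- An edge-coloring is given by a colour α u v for each ordered pair; only the
-- values on edges matter.
IsProperEdgeColoring : (G : Graph) → ℕ → (Fin (n G) → Fin (n G) → ℕ) → Set
IsProperEdgeColoring G t α =
  (∀ u v → Adj G u v → α u v ≡ α v u) ×
  (∀ u v → Adj G u v → (1 ≤ α u v) × (α u v ≤ t)) ×
  (∀ k → 1 ≤ k → k ≤ t → Σ (Fin (n G)) λ u → Σ (Fin (n G)) λ v → Adj G u v × (α u v ≡ k)) ×
  (∀ u v w → Adj G u v → Adj G u w → v ≢ w → α u v ≢ α u w)

defSet : List ℕ → ℕ
defSet [] = 0
defSet (x ∷ xs) =
  let A = deduplicate _≟_ (x ∷ xs)
  in (suc (maxList A) ∸ minList 0 A) ∸ length A

spectrum : (G : Graph) → (Fin (n G) → Fin (n G) → ℕ) → Fin (n G) → List ℕ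
spectrum G α v = map (α v) (nbrs G v)

defVertex : (G : Graph) → (Fin (n G) → Fin (n G) → ℕ) → Fin (n G) → ℕ
defVertex G α v = defSet (spectrum G α v)

defColoring : (G : Graph) → (Fin (n G) → Fin (n G) → ℕ) → ℕ
defColoring G α = sum (map (defVertex G α) (allFin (n G)))

AttainsDef : (G : Graph) → (Fin (n G) → Fin (n G) → ℕ) → Set
AttainsDef G α =
  ∀ t' β → IsProperEdgeColoring G t' β → defColoring G α ≤ defColoring G β

module Submission where

-- Fix a proper t-colouring α of G with total deficiency D and suppose t + D < 2δ.
-- Every spectrum S(v) has at least δ colours in [1, t], so its hull [min S(v), max S(v)] contains
-- the window [t − δ + 1, δ], and at most def(v) colours of the window are absent from S(v).
-- The window has 2δ − t > D colours, so one of them is absent from no spectrum; its colour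
-- class is then a perfect matching.

open import Defs
open import Data.Nat using (ℕ; _+_; _*_; _≤_)
open import Data.Fin using (Fin)
open import Relation.Nullary using (¬_)

open import Data.Nat using (suc; _∸_; _<_; _⊓_; _⊔_; z≤n; s≤s; _≤?_)
import Data.Nat as ℕ
open import Data.Nat.Properties
open import Data.Nat.ListAction using (sum)
open import Data.Nat.Tactic.RingSolver using (solve)
import Data.Fin.Properties as Fin
open import Data.Bool using (T; true) renaming (_≟_ to _≟ᵇ_)
open import Data.Bool.Properties using (T-≡)
open import Data.Empty using (⊥)
open import Data.Product using (∃; _×_; _,_; proj₁; proj₂)
open import Data.Sum using (_⊎_; inj₁; inj₂)
open import Data.List using (List; []; _∷_; map; filter; length; deduplicate; _++_; concatMap; applyUpTo; allFin)
open import Data.List.Properties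
  using (length-++; length-map; length-applyUpTo; length-removeAt′; foldr-preservesᵇ; foldr-preservesᵒ)
open import Data.List.Relation.Unary.Any as Any using (Any; here; there; index; any?)
import Data.List.Relation.Unary.All as All
import Data.List.Relation.Unary.All.Properties as All
open import Data.List.Relation.Unary.AllPairs using ([]; _∷_)
open import Data.List.Relation.Unary.Unique.Propositional using (Unique)
import Data.List.Relation.Unary.Unique.Propositional.Properties as Unique
import Data.List.Relation.Unary.Unique.DecPropositional.Properties as Unique
open import Data.List.Relation.Binary.Subset.Propositional using (_⊆_)
open import Data.List.Membership.Propositional using (_∈_; _∉_; _─_; find; lose)
open import Data.List.Membership.Propositional.Properties
open import Function using (_∘_; Equivalence)
open import Relation.Binary.Definitions using (DecidableEquality)
open import Relation.Nullary using (yes; no; contradiction)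
open import Relation.Nullary.Decidable using (¬?; decidable-stable)
open import Relation.Binary.PropositionalEquality as ≡ using (_≡_; _≢_; refl; subst)

module _ {A : Set} where

  ∈-─⁺ : ∀ {x y} {ys : List A} (x∈ys : x ∈ ys) → y ∈ ys → y ≢ x → y ∈ ys ─ x∈ys
  ∈-─⁺ (here refl) (here refl) y≢x = contradiction refl y≢x
  ∈-─⁺ (here refl) (there y∈ys) _ = y∈ys
  ∈-─⁺ (there x∈ys) (here refl) _ = here refl
  ∈-─⁺ (there x∈ys) (there y∈ys) y≢x = there (∈-─⁺ x∈ys y∈ys y≢x)

  Unique-⊆⇒length-≤ : ∀ {xs ys : List A} → Unique xs → xs ⊆ ys → length xs ≤ length ys
  Unique-⊆⇒length-≤ [] _ = z≤n
  Unique-⊆⇒length-≤ {x ∷ xs} {ys} (x∉xs ∷ xs!) xs⊆ys = begin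
    suc (length xs)          ≤⟨ s≤s (Unique-⊆⇒length-≤ xs! xs⊆ys─x) ⟩
    suc (length (ys ─ x∈ys)) ≡⟨ ≡.sym (length-removeAt′ ys (index x∈ys)) ⟩
    length ys                ∎
    where
    open ≤-Reasoning
    x∈ys = xs⊆ys (here refl)
    xs⊆ys─x : xs ⊆ ys ─ x∈ys
    xs⊆ys─x y∈xs = ∈-─⁺ x∈ys (xs⊆ys (there y∈xs)) (All.lookup x∉xs y∈xs ∘ ≡.sym)

  length-concatMap-≤ : ∀ {B : Set} (F : A → List B) (g : A → ℕ) →
    (∀ v → length (F v) ≤ g v) → ∀ vs → length (concatMap F vs) ≤ sum (map g vs)
  length-concatMap-≤ F g |F|≤g [] = z≤n
  length-concatMap-≤ F g |F|≤g (v ∷ vs) = begin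
    length (F v ++ concatMap F vs)          ≡⟨ length-++ (F v) ⟩
    length (F v) + length (concatMap F vs) ≤⟨ +-mono-≤ (|F|≤g v) (length-concatMap-≤ F g |F|≤g vs) ⟩
    g v + sum (map g vs)                   ∎
    where open ≤-Reasoning

  Unique-map⁺-on : ∀ {B : Set} {f : A → B} {xs} →
    (∀ {x y} → x ∈ xs → y ∈ xs → f x ≡ f y → x ≡ y) → Unique xs → Unique (map f xs)
  Unique-map⁺-on inj [] = []
  Unique-map⁺-on inj (x∉xs ∷ xs!) =
    All.map⁺ (All.tabulate λ y∈xs fx≡fy → All.lookup x∉xs y∈xs (inj (here refl) (there y∈xs) fx≡fy))
    ∷ Unique-map⁺-on (λ x∈ y∈ → inj (there x∈) (there y∈)) xs!

module _ {A : Set} (_≟_ : DecidableEquality A) where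

  open import Data.List.Membership.DecPropositional _≟_ using (_∈?_)

  missing : List A → List A → List A
  missing R S = filter (λ r → ¬? (r ∈? S)) R

  ∈-missing⁻ : ∀ {r R S} → r ∈ missing R S → r ∈ R × r ∉ S
  ∈-missing⁻ {S = S} = ∈-filter⁻ (λ r → ¬? (r ∈? S))

  missing-unique : ∀ {R} S → Unique R → Unique (missing R S)
  missing-unique S = Unique.filter⁺ (λ r → ¬? (r ∈? S))

  ∉-missing⇒∈ : ∀ {r R S} → r ∈ R → r ∉ missing R S → r ∈ S
  ∉-missing⇒∈ {r} {R} {S} r∈R r∉ =
    decidable-stable (r ∈? S) (r∉ ∘ ∈-filter⁺ (λ r → ¬? (r ∈? S)) r∈R)

  Unique-length<⇒∃∉ : ∀ {R C : List A} → Unique R → length C < length R → ∃ λ r → r ∈ R × r ∉ C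
  Unique-length<⇒∃∉ {R} {C} R! |C|<|R| with any? (λ r → ¬? (r ∈? C)) R
  ... | yes ∃r∉C = find ∃r∉C
  ... | no ∄r∉C = contradiction (Unique-⊆⇒length-≤ R! R⊆C) (<⇒≱ |C|<|R|)
    where
    R⊆C : R ⊆ C
    R⊆C {r} r∈R = decidable-stable (r ∈? C) (∄r∉C ∘ lose r∈R)

infix 4 _⊆[_,_]
_⊆[_,_] : List ℕ → ℕ → ℕ → Set
xs ⊆[ a , b ] = ∀ {x} → x ∈ xs → a ≤ x × x ≤ b

interval : ℕ → ℕ → List ℕ
interval a b = applyUpTo (a +_) (suc b ∸ a)

length-interval : ∀ a b → length (interval a b) ≡ suc b ∸ a
length-interval a b = length-applyUpTo (a +_) (suc b ∸ a)

interval-unique : ∀ a b → Unique (interval a b)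
interval-unique a b = Unique.applyUpTo⁺₁ (a +_) (suc b ∸ a) (λ i<j _ → <⇒≢ (+-monoʳ-< a i<j))

∈-interval⁺ : ∀ {a b x} → a ≤ x → x ≤ b → x ∈ interval a b
∈-interval⁺ {a} {b} a≤x x≤b =
  subst (_∈ interval a b) (m+[n∸m]≡n a≤x) (∈-applyUpTo⁺ (a +_) (∸-monoˡ-< (s≤s x≤b) a≤x))

∈-interval⁻ : ∀ {a b x} → x ∈ interval a b → a ≤ x × x ≤ b
∈-interval⁻ {a} {b} x∈ with i , i<len , refl ← ∈-applyUpTo⁻ (a +_) x∈ =
  m≤m+n a i , ℕ.s≤s⁻¹ (subst (a + i <_) (m+[n∸m]≡n (<⇒≤ a<1+b)) (+-monoʳ-< a i<len))
  where
  a<1+b : a < suc b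
  a<1+b = ∸-cancelʳ-< (subst (_< suc b ∸ a) (≡.sym (n∸n≡0 (suc b))) (≤-trans (s≤s z≤n) i<len))

Unique-⊆[a,b]⇒length-≤ : ∀ {xs a b} → Unique xs → xs ⊆[ a , b ] → length xs ≤ suc b ∸ a
Unique-⊆[a,b]⇒length-≤ {xs} {a} {b} xs! xs⊆[a,b] =
  subst (length xs ≤_) (length-interval a b)
    (Unique-⊆⇒length-≤ xs! (λ x∈xs → let a≤x , x≤b = xs⊆[a,b] x∈xs in ∈-interval⁺ a≤x x≤b))

minList-≤ : ∀ d {xs z} → z ∈ xs → minList d xs ≤ z
minList-≤ d {x ∷ xs} {z} z∈ =
  foldr-preservesᵒ {P = _≤ z} pres x xs (lift z∈)
  where
  pres : ∀ u v → u ≤ z ⊎ v ≤ z → u ⊓ v ≤ z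
  pres u v (inj₁ u≤z) = ≤-trans (m⊓n≤m u v) u≤z
  pres u v (inj₂ v≤z) = ≤-trans (m⊓n≤n u v) v≤z
  lift : z ∈ x ∷ xs → x ≤ z ⊎ Any (_≤ z) xs
  lift (here refl) = inj₁ ≤-refl
  lift (there z∈xs) = inj₂ (Any.map (≤-reflexive ∘ ≡.sym) z∈xs)

≤-minList : ∀ d {x xs b} → (∀ {z} → z ∈ x ∷ xs → b ≤ z) → b ≤ minList d (x ∷ xs)
≤-minList d {x} {xs} b≤ =
  foldr-preservesᵇ {P = _ ≤_} ⊓-glb (b≤ (here refl)) (All.tabulate (b≤ ∘ there))

≤-maxList : ∀ {xs z} → z ∈ xs → z ≤ maxList xs
≤-maxList {xs} {z} z∈xs = foldr-preservesᵒ {P = z ≤_} pres 0 xs (inj₂ (Any.map ≤-reflexive z∈xs))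
  where
  pres : ∀ u v → z ≤ u ⊎ z ≤ v → z ≤ u ⊔ v
  pres u v (inj₁ z≤u) = m≤n⇒m≤n⊔o v z≤u
  pres u v (inj₂ z≤v) = m≤n⇒m≤o⊔n u z≤v

maxList-≤ : ∀ {xs b} → (∀ {z} → z ∈ xs → z ≤ b) → maxList xs ≤ b
maxList-≤ ≤b = foldr-preservesᵇ {P = _≤ _} ⊔-lub z≤n (All.tabulate ≤b)

minList-≤-bound : ∀ {xs b} → (∀ {z} → z ∈ xs → z ≤ b) → minList 0 xs ≤ b
minList-≤-bound {[]} _ = z≤n
minList-≤-bound {x ∷ xs} ≤b = ≤-trans (minList-≤ 0 {x ∷ xs} (here refl)) (≤b (here refl))

⊆[minList,maxList] : ∀ xs → xs ⊆[ minList 0 xs , maxList xs ]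
⊆[minList,maxList] xs z∈ = minList-≤ 0 z∈ , ≤-maxList z∈

length-missing≤defSet : ∀ x xs {R} → let A = deduplicate ℕ._≟_ (x ∷ xs) in
  Unique R → R ⊆[ minList 0 A , maxList A ] → length (missing ℕ._≟_ R A) ≤ defSet (x ∷ xs)
length-missing≤defSet x xs {R} R! R⊆hull =
  m+n≤o⇒m≤o∸n _ (subst (_≤ _) (length-++ (missing ℕ._≟_ R A))
    (Unique-⊆[a,b]⇒length-≤ (Unique.++⁺ (missing-unique ℕ._≟_ A R!) A! disjoint) ⊆hull))
  where
  A = deduplicate ℕ._≟_ (x ∷ xs)
  A! : Unique A
  A! = Unique.deduplicate-! ℕ._≟_ (x ∷ xs)
  disjoint : ∀ {r} → r ∈ missing ℕ._≟_ R A × r ∈ A → ⊥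
  disjoint (r∈missing , r∈A) = proj₂ (∈-missing⁻ ℕ._≟_ {R = R} r∈missing) r∈A
  ⊆hull : missing ℕ._≟_ R A ++ A ⊆[ minList 0 A , maxList A ]
  ⊆hull r∈ with ∈-++⁻ (missing ℕ._≟_ R A) r∈
  ... | inj₁ r∈missing = R⊆hull (proj₁ (∈-missing⁻ ℕ._≟_ {R = R} r∈missing))
  ... | inj₂ r∈A = ⊆[minList,maxList] A r∈A

window-within-hull : ∀ {t d} x xs → Unique (x ∷ xs) → x ∷ xs ⊆[ 1 , t ] → d ≤ length (x ∷ xs) →
  minList 0 (x ∷ xs) ≤ suc (t ∸ d) × d ≤ maxList (x ∷ xs)
window-within-hull {t} {d} x xs A! A⊆[1,t] d≤|A| = m≤1+t∸d , d≤M
  where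
  A = x ∷ xs
  m = minList 0 A
  M = maxList A
  open ≤-Reasoning
  1≤m : 1 ≤ m
  1≤m = ≤-minList 0 (proj₁ ∘ A⊆[1,t])
  M≤t : M ≤ t
  M≤t = maxList-≤ (proj₂ ∘ A⊆[1,t])
  d≤t : d ≤ t
  d≤t = ≤-trans d≤|A| (Unique-⊆[a,b]⇒length-≤ A! A⊆[1,t])
  |A|+m≤1+M : length A + m ≤ suc M
  |A|+m≤1+M = m≤o∸n⇒m+n≤o (length A) (m≤n⇒m≤1+n m≤M)
    (Unique-⊆[a,b]⇒length-≤ A! (⊆[minList,maxList] A))
    where m≤M = let m≤x , x≤M = ⊆[minList,maxList] A (here refl) in ≤-trans m≤x x≤M
  m≤1+t∸d : m ≤ suc (t ∸ d)
  m≤1+t∸d = subst (m ≤_) (+-∸-assoc 1 d≤t) (m+n≤o⇒m≤o∸n m (begin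
    m + d        ≤⟨ +-monoʳ-≤ m d≤|A| ⟩
    m + length A ≡⟨ +-comm m (length A) ⟩
    length A + m ≤⟨ |A|+m≤1+M ⟩
    suc M        ≤⟨ s≤s M≤t ⟩
    suc t        ∎))
  d≤M : d ≤ M
  d≤M = ℕ.s≤s⁻¹ (begin
    suc d        ≡⟨ +-comm 1 d ⟩
    d + 1        ≤⟨ +-mono-≤ d≤|A| 1≤m ⟩
    length A + m ≤⟨ |A|+m≤1+M ⟩
    suc M        ∎)

missing-window≤defSet : ∀ {t d} (S : List ℕ) → Unique S → S ⊆[ 1 , t ] → 0 < d → d ≤ length S →
  length (missing ℕ._≟_ (interval (suc (t ∸ d)) d) (deduplicate ℕ._≟_ S)) ≤ defSet S
missing-window≤defSet [] _ _ 0<d d≤0 = contradiction d≤0 (<⇒≱ 0<d)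
missing-window≤defSet {t} {d} S@(x ∷ xs) S! S⊆[1,t] _ d≤|S| =
  length-missing≤defSet x xs (interval-unique _ _) window⊆hull
  where
  A = deduplicate ℕ._≟_ S
  A! : Unique A
  A! = Unique.deduplicate-! ℕ._≟_ S
  hull : minList 0 A ≤ suc (t ∸ d) × d ≤ maxList A
  hull = window-within-hull x _ A! (S⊆[1,t] ∘ ∈-deduplicate⁻ ℕ._≟_ S)
    (≤-trans d≤|S| (Unique-⊆⇒length-≤ S! (∈-deduplicate⁺ ℕ._≟_)))
  window⊆hull : interval (suc (t ∸ d)) d ⊆[ minList 0 A , maxList A ]
  window⊆hull r∈ = let lo≤r , r≤hi = ∈-interval⁻ r∈ in
    ≤-trans (proj₁ hull) lo≤r , ≤-trans r≤hi (proj₂ hull)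

t+D<2d⇒D<d∸[t∸d] : ∀ {d t D} → d ≤ t → t + D < 2 * d → D < d ∸ (t ∸ d)
t+D<2d⇒D<d∸[t∸d] {d} {D = D} d≤t t+D<2d with e , refl ← m≤n⇒∃[o]m+o≡n d≤t
  rewrite m+n∸m≡n d e = m+n≤o⇒m≤o∸n (suc D) (+-cancelˡ-≤ d _ _ (begin
    d + (suc D + e) ≡⟨ solve (d ∷ e ∷ D ∷ []) ⟩
    suc (d + e + D) ≤⟨ t+D<2d ⟩
    2 * d           ≡⟨ solve (d ∷ e ∷ D ∷ []) ⟩
    d + d           ∎))
  where open ≤-Reasoning

module _ (G : Graph) where

  Adj-sym : ∀ {u v} → Adj G u v → Adj G v u
  Adj-sym {u} {v} = subst T (Graph.sym G u v)

  ∈-nbrs⇒Adj : ∀ {v u} → u ∈ nbrs G v → Adj G v u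
  ∈-nbrs⇒Adj {v} u∈ =
    Equivalence.from T-≡ (proj₂ (∈-filter⁻ (λ u → adj G v u ≟ᵇ true) {xs = allFin (n G)} u∈))

  nbrs-unique : ∀ v → Unique (nbrs G v)
  nbrs-unique v = Unique.filter⁺ _ (Unique.allFin⁺ (n G))

  δ≤degree : ∀ v → δ G ≤ degree G v
  δ≤degree v = minList-≤ 0 (∈-map⁺ (degree G) (∈-allFin v))

module _ (G : Graph) (t : ℕ) (α : Fin (n G) → Fin (n G) → ℕ) (α-proper : IsProperEdgeColoring G t α) where

  private
    α-sym = proj₁ α-proper
    α-range = proj₁ (proj₂ α-proper)
    α-distinct = proj₂ (proj₂ (proj₂ α-proper))

  spectrum-unique : ∀ v → Unique (spectrum G α v)
  spectrum-unique v = Unique-map⁺-on α-injective (nbrs-unique G v)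
    where
    α-injective : ∀ {u w} → u ∈ nbrs G v → w ∈ nbrs G v → α v u ≡ α v w → u ≡ w
    α-injective {u} {w} u∈ w∈ αvu≡αvw = decidable-stable (u Fin.≟ w)
      λ u≢w → α-distinct v u w (∈-nbrs⇒Adj G u∈) (∈-nbrs⇒Adj G w∈) u≢w αvu≡αvw

  spectrum⊆[1,t] : ∀ v → spectrum G α v ⊆[ 1 , t ]
  spectrum⊆[1,t] v c∈ with u , u∈ , refl ← ∈-map⁻ (α v) c∈ = α-range v u (∈-nbrs⇒Adj G u∈)

  degree≤t : ∀ v → degree G v ≤ t
  degree≤t v = subst (_≤ t) (length-map (α v) (nbrs G v))
    (Unique-⊆[a,b]⇒length-≤ (spectrum-unique v) (spectrum⊆[1,t] v))

  δ≤t : δ G ≤ t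
  δ≤t = minList-≤-bound {map (degree G) (allFin (n G))} λ d∈ →
    let v , _ , d≡ = ∈-map⁻ (degree G) d∈ in subst (_≤ t) (≡.sym d≡) (degree≤t v)

  colour-everywhere⇒perfect-matching : ∀ c → (∀ v → c ∈ spectrum G α v) → HasPerfectMatching G
  colour-everywhere⇒perfect-matching c c∈spectrum = partner , partner-adj , partner-involutive
    where
    edge : ∀ v → ∃ λ u → u ∈ nbrs G v × c ≡ α v u
    edge v = ∈-map⁻ (α v) (c∈spectrum v)
    partner : Fin (n G) → Fin (n G)
    partner v = proj₁ (edge v)
    partner-adj : ∀ v → Adj G v (partner v)
    partner-adj v = ∈-nbrs⇒Adj G (proj₁ (proj₂ (edge v)))
    partner-colour : ∀ v → α v (partner v) ≡ c
    partner-colour v = ≡.sym (proj₂ (proj₂ (edge v)))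
    partner-involutive : ∀ v → partner (partner v) ≡ v
    partner-involutive v = decidable-stable (w Fin.≟ v)
      λ w≢v → α-distinct u v w (Adj-sym G (partner-adj v)) (partner-adj u) (w≢v ∘ ≡.sym) (begin
        α u v ≡⟨ α-sym u v (Adj-sym G (partner-adj v)) ⟩
        α v u ≡⟨ partner-colour v ⟩
        c     ≡⟨ ≡.sym (partner-colour u) ⟩
        α u w ∎)
      where
      open ≡.≡-Reasoning
      u = partner v
      w = partner u

  few-defects⇒perfect-matching : t + defColoring G α < 2 * δ G → HasPerfectMatching G
  few-defects⇒perfect-matching budget = colour-everywhere⇒perfect-matching c c∈spectrum
    where
    window : List ℕ
    window = interval (suc (t ∸ δ G)) (δ G)
    D<δ∸[t∸δ] : defColoring G α < δ G ∸ (t ∸ δ G)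
    D<δ∸[t∸δ] = t+D<2d⇒D<d∸[t∸d] δ≤t budget
    missingAt : Fin (n G) → List ℕ
    missingAt v = missing ℕ._≟_ window (deduplicate ℕ._≟_ (spectrum G α v))
    D<|window| : defColoring G α < length window
    D<|window| = subst (defColoring G α <_) (≡.sym (length-interval (suc (t ∸ δ G)) (δ G))) D<δ∸[t∸δ]
    0<δ : 0 < δ G
    0<δ = ≤-trans (s≤s z≤n) (≤-trans D<δ∸[t∸δ] (m∸n≤m (δ G) (t ∸ δ G)))
    |missingAt|≤defVertex : ∀ v → length (missingAt v) ≤ defVertex G α v
    |missingAt|≤defVertex v =
      missing-window≤defSet (spectrum G α v) (spectrum-unique v) (spectrum⊆[1,t] v) 0<δ
        (subst (δ G ≤_) (≡.sym (length-map (α v) (nbrs G v))) (δ≤degree G v))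
    common : ∃ λ c → c ∈ window × c ∉ concatMap missingAt (allFin (n G))
    common = Unique-length<⇒∃∉ ℕ._≟_ (interval-unique _ _)
      (<-≤-trans (s≤s (length-concatMap-≤ missingAt (defVertex G α) |missingAt|≤defVertex (allFin (n G))))
                 D<|window|)
    c = proj₁ common
    c∈spectrum : ∀ v → c ∈ spectrum G α v
    c∈spectrum v = let _ , c∈window , c∉missing = common in
      ∈-deduplicate⁻ ℕ._≟_ _ (∉-missing⇒∈ ℕ._≟_ c∈window
        (c∉missing ∘ λ c∈ → ∈-concat⁺′ c∈ (∈-map⁺ missingAt (∈-allFin v))))

theorem2p3 : (G : Graph) → ¬ HasPerfectMatching G →
    (t : ℕ) (α : Fin (n G) → Fin (n G) → ℕ) →
    IsProperEdgeColoring G t α → AttainsDef G α →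
    2 * δ G ≤ t + defColoring G α
theorem2p3 G no-pm t α α-proper _ = decidable-stable (2 * δ G ≤? t + defColoring G α)
  (no-pm ∘ few-defects⇒perfect-matching G t α α-proper ∘ ≰⇒>)
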